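{- For every $n\ge 1$, Snort played on the (initially uncoloured, untinted) graph $G_n$ is a first player win, where $G_n$ is obtained from $T_{n,3}$ by adding one new vertex $R_3$ and the edges $(n,2)\sim R_3$, $(n,3)\sim R_3$.
   Context: Snort is a two-player game (players Left and Right) played on a finite simple graph. The players alternately colour a previously uncoloured vertex, Left in blue and Right in red, subject to the rule that no two adjacent vertices may receive opposite colours. Normal play: a player who cannot move on their turn loses. A game is a "first player win" if the player who moves first has a winning strategy, regardless of whether that player is Left or Right. $T_{n,3}$ is the graph with vertex set $\{(i,j): 1\le i\le n,\ 1\le j\le 3\}$ and edges $(i,j)\sim(i+1,j)$ for $1\le i\le n-1$, $1\le j\le 3$; $(i,j)\sim(i,j+1)$ for $1\le i\le n$, $1\le j\le 2$; and $(i,j)\sim(i+1,j+1)$ for $1\le i\le n-1$, $1\le j\le 2$. -}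

module Defs where

open import Data.Nat using (ℕ; zero; suc; _+_)
open import Data.Fin using (Fin; toℕ)
import Data.Fin.Properties as FinP
open import Data.Product using (_×_; _,_)
import Data.Product.Properties as ProdP
open import Data.Sum using (_⊎_; inj₁; inj₂)
import Data.Sum.Properties as SumP
open import Data.Unit using (⊤; tt)
import Data.Unit.Properties as UnitP
open import Data.Maybe using (Maybe; just; nothing)
open import Data.Empty using (⊥)
open import Relation.Nullary using (¬_; yes; no)
open import Relation.Binary.PropositionalEquality using (_≡_; _≢_)
open import Relation.Binary.Definitions using (DecidableEquality)

data Colour : Set where
  blue red : Colour

Player : Set
Player = Colour

Left Right : Player
Left  = blue
Right = red

opp : Colour → Colour
opp blue = red
opp red  = blue

record Graph : Set₁ where
  field
    V     : Set
    _≟V_  : DecidableEquality V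
    Adj   : V → V → Set

Position : Graph → Set
Position G = Graph.V G → Maybe Colour

emptyPos : (G : Graph) → Position G
emptyPos G _ = nothing

record LegalMove (G : Graph) (p : Position G) (c : Colour) (v : Graph.V G) : Set where
  field
    uncoloured : p v ≡ nothing
    noConflict : ∀ u → Graph.Adj G u v → p u ≢ just (opp c)

play : (G : Graph) → Position G → Colour → Graph.V G → Position G
play G p c v u with Graph._≟V_ G u v
... | yes _ = just c
... | no  _ = p u

-- Both are inductive, hence
-- describe finite winning strategies.
data WinsMoving (G : Graph) : Player → Position G → Set
data LosesMoving (G : Graph) : Player → Position G → Set

data WinsMoving G where
  move : ∀ {p pos} (v : Graph.V G) → LegalMove G pos p v →
         LosesMoving G (opp p) (play G pos p v) → WinsMoving G p pos

data LosesMoving G where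
  allMoves : ∀ {p pos} →
             (∀ (v : Graph.V G) → LegalMove G pos p v →
                WinsMoving G (opp p) (play G pos p v)) →
             LosesMoving G p pos

FirstPlayerWin : Graph → Set
FirstPlayerWin G = WinsMoving G Left (emptyPos G) × WinsMoving G Right (emptyPos G)

-- The graph G_n = T_{n,3} plus a vertex R₃ joined to (n,2) and (n,3).
-- Vertex (i,j) of the paper (1 ≤ i ≤ n, 1 ≤ j ≤ 3) is inj₁ (i' , j')
-- with toℕ i' = i - 1, toℕ j' = j - 1; R₃ is inj₂ tt.

GV : ℕ → Set
GV n = (Fin n × Fin 3) ⊎ ⊤

data GEdge (n : ℕ) : GV n → GV n → Set where
  vert  : ∀ {i i' j} → toℕ i' ≡ suc (toℕ i) →
          GEdge n (inj₁ (i , j)) (inj₁ (i' , j))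
  horiz : ∀ {i j j'} → toℕ j' ≡ suc (toℕ j) →
          GEdge n (inj₁ (i , j)) (inj₁ (i , j'))
  diag  : ∀ {i i' j j'} → toℕ i' ≡ suc (toℕ i) → toℕ j' ≡ suc (toℕ j) →
          GEdge n (inj₁ (i , j)) (inj₁ (i' , j'))
  toR₃  : ∀ {i j} → suc (toℕ i) ≡ n → (toℕ j ≡ 1 ⊎ toℕ j ≡ 2) →
          GEdge n (inj₁ (i , j)) (inj₂ tt)

GAdj : (n : ℕ) → GV n → GV n → Set
GAdj n u v = GEdge n u v ⊎ GEdge n v u

Gn : ℕ → Graph
Gn n = record
  { V    = GV n
  ; _≟V_ = SumP.≡-dec (ProdP.≡-dec FinP._≟_ FinP._≟_) UnitP._≟_
  ; Adj  = GAdj n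
  }

{-# OPTIONS --safe #-}
module Submission where

-- A Tweedledum–Tweedledee strategy.  Write n = k + 1 + t with t ∈ {k, k+1},
-- put vertex (i, j) at the point (i-1, j-1) of ℕ² and R₃ at (n, 2), and let
-- the first player colour the centre (t, 1).  Every vertex that is neither
-- the centre nor adjacent to it lies either in the block L made of the
-- columns < k together with (k, 2), or in its translate L + (t+1), which
-- consists of the columns > t together with R₃.  The first player answers
-- each move by the translate of the opponent's vertex in the other block.
-- Translation preserves adjacency, and the only edge between L and
-- L + (t+1) joins two neighbours of the centre, so every answer is legal.

open import Defs
open import Data.Nat using (ℕ; zero; suc; _+_; _∸_; _≤_; _<_; _≥_; z≤n; s≤s; s≤s⁻¹; z<s; _≤?_; _<?_; ⌊_/2⌋; ⌈_/2⌉)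
open import Data.Nat.Properties
open import Data.Fin using (Fin; toℕ; fromℕ<)
open import Data.Fin.Properties using (toℕ<n; toℕ-injective; toℕ-fromℕ<)
open import Data.Product using (_×_; _,_; proj₁; proj₂)
open import Data.Sum using (_⊎_; inj₁; inj₂)
import Data.Sum as Sum
open import Data.Unit using (tt)
open import Data.Maybe using (Maybe; just; nothing)
open import Data.Maybe.Properties using (just-injective)
open import Data.List using (List; []; _∷_; map; _++_; cartesianProduct; allFin)
open import Data.Nat.ListAction using (sum)
open import Data.List.Relation.Unary.Any using (here; there)
open import Data.List.Membership.Propositional using (_∈_)
open import Data.List.Membership.Propositional.Properties using (∈-map⁺; ∈-++⁺ˡ; ∈-++⁺ʳ; ∈-cartesianProduct⁺; ∈-allFin)
open import Data.Empty using (⊥-elim)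
open import Function using (_∘_)
open import Relation.Nullary using (¬_; yes; no; Dec)
open import Relation.Nullary.Decidable using (_⊎-dec_; _×-dec_)
open import Relation.Binary.PropositionalEquality

opp-involutive : ∀ a → opp (opp a) ≡ a
opp-involutive blue = refl
opp-involutive red  = refl

opp-≢ : ∀ a → a ≢ opp a
opp-≢ blue ()
opp-≢ red  ()

module _ (G : Graph) where
  open Graph G

  play-self : ∀ (p : Position G) a v → play G p a v v ≡ just a
  play-self p a v with v ≟V v
  ... | yes _  = refl
  ... | no v≢v = ⊥-elim (v≢v refl)

  play-other : ∀ (p : Position G) a {u v} → u ≢ v → play G p a v u ≡ p u
  play-other p a {u} {v} u≢v with u ≟V v
  ... | yes u≡v = ⊥-elim (u≢v u≡v)
  ... | no _    = refl

  play-nothing : ∀ (p : Position G) a {u v} → play G p a v u ≡ nothing → u ≢ v × p u ≡ nothing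
  play-nothing p a {u} {v} e with u ≟V v
  play-nothing p a {u} {v} () | yes _
  ... | no u≢v = u≢v , e

  play-just : ∀ (p : Position G) a {b u v} → play G p a v u ≡ just b →
              (u ≡ v × a ≡ b) ⊎ (u ≢ v × p u ≡ just b)
  play-just p a {b} {u} {v} e with u ≟V v
  ... | yes u≡v = inj₁ (u≡v , just-injective e)
  ... | no u≢v  = inj₂ (u≢v , e)

  play-keeps : ∀ (p : Position G) a {b u v} → p u ≡ just b → p v ≡ nothing → play G p a v u ≡ just b
  play-keeps p a {b} {u} {v} pu pv = trans (play-other p a u≢v) pu
    where
    u≢v : u ≢ v
    u≢v u≡v with trans (sym pu) (trans (cong p u≡v) pv)
    ... | ()

  isUncoloured : Maybe Colour → ℕ
  isUncoloured nothing  = 1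
  isUncoloured (just _) = 0

  #uncoloured : List V → Position G → ℕ
  #uncoloured vs p = sum (map (isUncoloured ∘ p) vs)

  isUncoloured-play-≤ : ∀ (p : Position G) a v u → isUncoloured (play G p a v u) ≤ isUncoloured (p u)
  isUncoloured-play-≤ p a v u with u ≟V v
  ... | yes _ = z≤n
  ... | no _  = ≤-refl

  #uncoloured-play-≤ : ∀ vs (p : Position G) a v → #uncoloured vs (play G p a v) ≤ #uncoloured vs p
  #uncoloured-play-≤ []       p a v = z≤n
  #uncoloured-play-≤ (u ∷ vs) p a v = +-mono-≤ (isUncoloured-play-≤ p a v u) (#uncoloured-play-≤ vs p a v)

  #uncoloured-play-< : ∀ {vs} (p : Position G) a {v} → p v ≡ nothing → v ∈ vs →
                       #uncoloured vs (play G p a v) < #uncoloured vs p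
  #uncoloured-play-< {v ∷ vs} p a {v} pv (here refl)
    rewrite play-self p a v | pv = s≤s (#uncoloured-play-≤ vs p a v)
  #uncoloured-play-< {u ∷ vs} p a {v} pv (there v∈vs) =
    +-mono-≤-< (isUncoloured-play-≤ p a v u) (#uncoloured-play-< p a pv v∈vs)

-- Once the centre carries the first player's colour, the opponent can only
-- ever play vertices that are far from it.
Far : (G : Graph) → Graph.V G → Graph.V G → Set
Far G x v = v ≢ x × ¬ Graph.Adj G x v

record Pairing (G : Graph) : Set where
  open Graph G
  field
    centre              : V
    partner             : V → V
    partner-involutive  : ∀ v → partner (partner v) ≡ v
    partner-centre      : partner centre ≡ centre
    partner-≢           : ∀ {v} → Far G centre v → partner v ≢ v
    partner-nonadjacent : ∀ {v} → Far G centre v → ¬ Adj v (partner v)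
    partner-swap        : ∀ {u v} → Far G centre u → Far G centre v →
                          Adj u (partner v) → Adj (partner u) v

module PairingStrategy {G : Graph} (vs : List (Graph.V G)) (vs-complete : ∀ v → v ∈ vs)
                       (π : Pairing G) (c : Colour) where
  open Graph G
  open Pairing π

  partner-injective : ∀ {u v} → partner u ≡ partner v → u ≡ v
  partner-injective {u} {v} e = trans (sym (partner-involutive u)) (trans (cong partner e) (partner-involutive v))

  record Invariant (pos : Position G) : Set where
    field
      centre-coloured : pos centre ≡ just c
      partner-free    : ∀ {w} → Far G centre w → pos w ≡ nothing → pos (partner w) ≡ nothing
      answered        : ∀ {u} → pos u ≡ just (opp c) → Far G centre u × pos (partner u) ≡ just c

  reply : Position G → V → Position G
  reply pos v = play G (play G pos (opp c) v) c (partner v)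

  module _ {pos : Position G} {v : V} (inv : Invariant pos) (legal : LegalMove G pos (opp c) v) where
    open Invariant inv
    open LegalMove legal

    no-c-neighbour : ∀ {u} → Adj u v → pos u ≢ just c
    no-c-neighbour {u} a e = noConflict u a (trans e (cong just (sym (opp-involutive c))))

    move-far : Far G centre v
    move-far = v≢centre , λ a → no-c-neighbour a centre-coloured
      where
      v≢centre : v ≢ centre
      v≢centre v≡centre with trans (sym uncoloured) (trans (cong pos v≡centre) centre-coloured)
      ... | ()

    partner-uncoloured : play G pos (opp c) v (partner v) ≡ nothing
    partner-uncoloured = trans (play-other G pos (opp c) (partner-≢ move-far)) (partner-free move-far uncoloured)

    reply-legal : LegalMove G (play G pos (opp c) v) c (partner v)
    reply-legal = record { uncoloured = partner-uncoloured ; noConflict = no-conflict }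
      where
      no-conflict : ∀ u → Adj u (partner v) → play G pos (opp c) v u ≢ just (opp c)
      no-conflict u a e with play-just G pos (opp c) e
      ... | inj₁ (u≡v , _)  = partner-nonadjacent move-far (subst (λ w → Adj w (partner v)) u≡v a)
      ... | inj₂ (_ , pu) with answered pu
      ...   | far-u , partner-u = no-c-neighbour (partner-swap far-u move-far a) partner-u

    reply-invariant : Invariant (reply pos v)
    reply-invariant = record
      { centre-coloured = keep centre-coloured
      ; partner-free    = free
      ; answered        = answer
      }
      where
      keep : ∀ {u b} → pos u ≡ just b → reply pos v u ≡ just b
      keep pu = play-keeps G _ c (play-keeps G pos (opp c) pu uncoloured) partner-uncoloured

      free : ∀ {w} → Far G centre w → reply pos v w ≡ nothing → reply pos v (partner w) ≡ nothing
      free {w} far-w e with play-nothing G _ c e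
      ... | w≢partner-v , e′ with play-nothing G pos (opp c) e′
      ...   | w≢v , pw = trans (play-other G _ c (w≢v ∘ partner-injective))
                           (trans (play-other G pos (opp c) partner-w≢v) (partner-free far-w pw))
        where
        partner-w≢v : partner w ≢ v
        partner-w≢v eq = w≢partner-v (partner-injective (trans eq (sym (partner-involutive v))))

      answer : ∀ {u} → reply pos v u ≡ just (opp c) → Far G centre u × reply pos v (partner u) ≡ just c
      answer e with play-just G _ c e
      ... | inj₁ (_ , c≡o) = ⊥-elim (opp-≢ c c≡o)
      ... | inj₂ (_ , e′) with play-just G pos (opp c) e′
      ...   | inj₁ (refl , _) = move-far , play-self G _ c (partner v)
      ...   | inj₂ (_ , pu) with answered pu
      ...     | far-u , partner-u = far-u , keep partner-u

  opponent-loses : ∀ n pos → #uncoloured G vs pos < n → Invariant pos → LosesMoving G (opp c) pos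
  opponent-loses (suc n) pos bound inv = allMoves λ v legal →
    subst (λ a → WinsMoving G a (play G pos (opp c) v)) (sym (opp-involutive c))
      (move (partner v) (reply-legal inv legal)
        (opponent-loses n (reply pos v) (bound′ v legal) (reply-invariant inv legal)))
    where
    bound′ : ∀ v → LegalMove G pos (opp c) v → #uncoloured G vs (reply pos v) < n
    bound′ v legal = <-trans
      (#uncoloured-play-< G _ c (partner-uncoloured inv legal) (vs-complete (partner v)))
      (<-≤-trans (#uncoloured-play-< G pos (opp c) (LegalMove.uncoloured legal) (vs-complete v)) (s≤s⁻¹ bound))

  opening : Position G
  opening = play G (emptyPos G) c centre

  opening-invariant : Invariant opening
  opening-invariant = record
    { centre-coloured = play-self G (emptyPos G) c centre
    ; partner-free    = λ far-w _ → play-other G (emptyPos G) c (partner-≢centre far-w)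
    ; answered        = answer
    }
    where
    partner-≢centre : ∀ {w} → Far G centre w → partner w ≢ centre
    partner-≢centre (w≢centre , _) e = w≢centre (partner-injective (trans e (sym partner-centre)))

    answer : ∀ {u} → opening u ≡ just (opp c) → Far G centre u × opening (partner u) ≡ just c
    answer e with play-just G (emptyPos G) c e
    ... | inj₁ (_ , c≡o) = ⊥-elim (opp-≢ c c≡o)
    ... | inj₂ (_ , ())

  wins : WinsMoving G c (emptyPos G)
  wins = move centre (record { uncoloured = refl ; noConflict = λ _ _ () })
           (opponent-loses _ opening (n<1+n _) opening-invariant)

pairing-first-player-win : ∀ {G} (vs : List (Graph.V G)) → (∀ v → v ∈ vs) → Pairing G → FirstPlayerWin G
pairing-first-player-win vs vs-complete π =
  PairingStrategy.wins vs vs-complete π Left , PairingStrategy.wins vs vs-complete π Right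

Point : Set
Point = ℕ × ℕ

data Step : Point → Point → Set where
  stepᵢ  : ∀ {i j i′ j′} → i′ ≡ suc i → j′ ≡ j     → Step (i , j) (i′ , j′)
  stepⱼ  : ∀ {i j i′ j′} → i′ ≡ i     → j′ ≡ suc j → Step (i , j) (i′ , j′)
  stepᵢⱼ : ∀ {i j i′ j′} → i′ ≡ suc i → j′ ≡ suc j → Step (i , j) (i′ , j′)

infix 4 _~_
_~_ : Point → Point → Set
p ~ q = Step p q ⊎ Step q p

~-sym : ∀ {p q} → p ~ q → q ~ p
~-sym = Sum.swap

Step-col-≤ : ∀ {i j i′ j′} → Step (i , j) (i′ , j′) → i ≤ i′
Step-col-≤ (stepᵢ  refl _) = n≤1+n _
Step-col-≤ (stepⱼ  refl _) = ≤-refl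
Step-col-≤ (stepᵢⱼ refl _) = n≤1+n _

infixl 6 _⊕_
_⊕_ : Point → ℕ → Point
(i , j) ⊕ m = i + m , j

Step-⊕ : ∀ m {p q} → Step p q → Step (p ⊕ m) (q ⊕ m)
Step-⊕ m (stepᵢ  e e′) = stepᵢ  (cong (_+ m) e) e′
Step-⊕ m (stepⱼ  e e′) = stepⱼ  (cong (_+ m) e) e′
Step-⊕ m (stepᵢⱼ e e′) = stepᵢⱼ (cong (_+ m) e) e′

Step-⊕⁻¹ : ∀ m {p q} → Step (p ⊕ m) (q ⊕ m) → Step p q
Step-⊕⁻¹ m {i , _} {i′ , _} (stepᵢ  e e′) = stepᵢ  (+-cancelʳ-≡ m i′ (suc i) e) e′
Step-⊕⁻¹ m {i , _} {i′ , _} (stepⱼ  e e′) = stepⱼ  (+-cancelʳ-≡ m i′ i e) e′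
Step-⊕⁻¹ m {i , _} {i′ , _} (stepᵢⱼ e e′) = stepᵢⱼ (+-cancelʳ-≡ m i′ (suc i) e) e′

~-⊕ : ∀ m {p q} → p ~ q → p ⊕ m ~ q ⊕ m
~-⊕ m = Sum.map (Step-⊕ m) (Step-⊕ m)

~-⊕⁻¹ : ∀ m {p q} → p ⊕ m ~ q ⊕ m → p ~ q
~-⊕⁻¹ m = Sum.map (Step-⊕⁻¹ m) (Step-⊕⁻¹ m)

module Coordinates (N : ℕ) where

  -- R₃ sits at (N, 2), whose grid neighbours in columns < N are exactly (N-1, 1) and (N-1, 2).
  pt : GV N → Point
  pt (inj₁ (i , j)) = toℕ i , toℕ j
  pt (inj₂ tt)      = N , 2

  InGrid : Point → Set
  InGrid (i , j) = (i < N × j < 3) ⊎ (i ≡ N × j ≡ 2)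

  pt-InGrid : ∀ v → InGrid (pt v)
  pt-InGrid (inj₁ (i , j)) = inj₁ (toℕ<n i , toℕ<n j)
  pt-InGrid (inj₂ tt)      = inj₂ (refl , refl)

  vertexAt : ∀ p → InGrid p → GV N
  vertexAt (i , j) (inj₁ (i<N , j<3)) = inj₁ (fromℕ< i<N , fromℕ< j<3)
  vertexAt _       (inj₂ _)           = inj₂ tt

  pt-vertexAt : ∀ p g → pt (vertexAt p g) ≡ p
  pt-vertexAt (i , j) (inj₁ (i<N , j<3)) = cong₂ _,_ (toℕ-fromℕ< i<N) (toℕ-fromℕ< j<3)
  pt-vertexAt (_ , _) (inj₂ (refl , refl)) = refl

  toℕ≢ : ∀ (i : Fin N) {m} → N ≤ m → toℕ i ≢ m
  toℕ≢ i N≤m = <⇒≢ (<-≤-trans (toℕ<n i) N≤m)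

  pt-injective : ∀ {u v} → pt u ≡ pt v → u ≡ v
  pt-injective {inj₁ (i , j)} {inj₁ (i′ , j′)} e =
    cong₂ (λ a b → inj₁ (a , b)) (toℕ-injective (cong proj₁ e)) (toℕ-injective (cong proj₂ e))
  pt-injective {inj₁ (i , _)} {inj₂ tt} e = ⊥-elim (toℕ≢ i ≤-refl (cong proj₁ e))
  pt-injective {inj₂ tt} {inj₁ (i , _)} e = ⊥-elim (toℕ≢ i ≤-refl (cong proj₁ (sym e)))
  pt-injective {inj₂ tt} {inj₂ tt}      _ = refl

  edge→Step : ∀ {u v} → GEdge N u v → Step (pt u) (pt v)
  edge→Step (vert e)              = stepᵢ e refl
  edge→Step (horiz e)             = stepⱼ refl e
  edge→Step (diag e e′)           = stepᵢⱼ e e′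
  edge→Step (toR₃ e (inj₁ j≡1))   = stepᵢⱼ (sym e) (cong suc (sym j≡1))
  edge→Step (toR₃ e (inj₂ j≡2))   = stepᵢ (sym e) (sym j≡2)

  Step→edge : ∀ u v → Step (pt u) (pt v) → GEdge N u v
  Step→edge (inj₁ (i , j)) (inj₁ (i′ , j′)) (stepᵢ e e′) with toℕ-injective e′
  ... | refl = vert e
  Step→edge (inj₁ (i , j)) (inj₁ (i′ , j′)) (stepⱼ e e′) with toℕ-injective e
  ... | refl = horiz e′
  Step→edge (inj₁ _) (inj₁ _) (stepᵢⱼ e e′) = diag e e′
  Step→edge (inj₁ _)       (inj₂ tt) (stepᵢ e e′)  = toR₃ (sym e) (inj₂ (sym e′))
  Step→edge (inj₁ (i , _)) (inj₂ tt) (stepⱼ e _)   = ⊥-elim (toℕ≢ i ≤-refl (sym e))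
  Step→edge (inj₁ _)       (inj₂ tt) (stepᵢⱼ e e′) = toR₃ (sym e) (inj₁ (suc-injective (sym e′)))
  Step→edge (inj₂ tt) (inj₁ (i , _)) (stepᵢ e _)   = ⊥-elim (toℕ≢ i (n≤1+n N) e)
  Step→edge (inj₂ tt) (inj₁ (i , _)) (stepⱼ e _)   = ⊥-elim (toℕ≢ i ≤-refl e)
  Step→edge (inj₂ tt) (inj₁ (i , _)) (stepᵢⱼ e _)  = ⊥-elim (toℕ≢ i (n≤1+n N) e)
  Step→edge (inj₂ tt) (inj₂ tt) (stepᵢ e _)  = ⊥-elim (1+n≢n (sym e))
  Step→edge (inj₂ tt) (inj₂ tt) (stepⱼ _ ())
  Step→edge (inj₂ tt) (inj₂ tt) (stepᵢⱼ _ ())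

  adj→~ : ∀ {u v} → GAdj N u v → pt u ~ pt v
  adj→~ = Sum.map edge→Step edge→Step

  ~→adj : ∀ {u v} → pt u ~ pt v → GAdj N u v
  ~→adj {u} {v} = Sum.map (Step→edge u v) (Step→edge v u)

module Translation (k t : ℕ) (k≤t : k ≤ t) (t≤1+k : t ≤ suc k) where

  s : ℕ
  s = suc t

  N : ℕ
  N = k + s

  open Coordinates N

  centreₚ : Point
  centreₚ = t , 1

  Farₚ : Point → Set
  Farₚ p = p ≢ centreₚ × ¬ centreₚ ~ p

  Low : Point → Set
  Low (i , j) = (i < k × j < 3) ⊎ (i ≡ k × j ≡ 2)

  low? : ∀ p → Dec (Low p)
  low? (i , j) = ((i <? k) ×-dec (j <? 3)) ⊎-dec ((i ≟ k) ×-dec (j ≟ 2))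

  Middle : Point → Set
  Middle p = ¬ Low p × proj₁ p < s × proj₂ p < 3

  low-col≤k : ∀ {i j} → Low (i , j) → i ≤ k
  low-col≤k (inj₁ (i<k , _)) = <⇒≤ i<k
  low-col≤k (inj₂ (refl , _)) = ≤-refl

  low-row<3 : ∀ {p} → Low p → proj₂ p < 3
  low-row<3 (inj₁ (_ , j<3))  = j<3
  low-row<3 (inj₂ (_ , refl)) = n<1+n 2

  low<high : ∀ {i j} → Low (i , j) → ∀ i′ → i < i′ + s
  low<high l i′ = ≤-<-trans (low-col≤k l) (<-≤-trans (s≤s k≤t) (m≤n+m s i′))

  low-InGrid : ∀ {p} → Low p → InGrid p
  low-InGrid (inj₁ (i<k , j<3)) = inj₁ (<-≤-trans i<k (m≤m+n k s) , j<3)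
  low-InGrid (inj₂ (refl , refl)) = inj₁ (m<m+n k z<s , n<1+n 2)

  low-⊕-InGrid : ∀ {p} → Low p → InGrid (p ⊕ s)
  low-⊕-InGrid (inj₁ (i<k , j<3)) = inj₁ (+-monoˡ-< s i<k , j<3)
  low-⊕-InGrid (inj₂ (refl , refl)) = inj₂ (refl , refl)

  high-low : ∀ {i j} → InGrid (i , j) → s ≤ i → Low (i ∸ s , j)
  high-low {i} (inj₁ (i<N , j<3)) s≤i =
    inj₁ (+-cancelʳ-< s (i ∸ s) k (subst (_< N) (sym (m∸n+n≡m s≤i)) i<N) , j<3)
  high-low (inj₂ (refl , refl)) _ = inj₂ (m+n∸n≡m k s , refl)

  ¬low-⊕ : ∀ {p} → ¬ Low (p ⊕ s)
  ¬low-⊕ {i , _} l = <-irrefl refl (low<high l i)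

  partnerₚ : Point → Point
  partnerₚ (i , j) with low? (i , j) | s ≤? i
  ... | yes _ | _     = (i , j) ⊕ s
  ... | no _  | yes _ = i ∸ s , j
  ... | no _  | no _  = i , j

  partnerₚ-low : ∀ {p} → Low p → partnerₚ p ≡ p ⊕ s
  partnerₚ-low {i , j} l with low? (i , j) | s ≤? i
  ... | yes _ | _ = refl
  ... | no ¬l | _ = ⊥-elim (¬l l)

  partnerₚ-high : ∀ {p} → Low p → partnerₚ (p ⊕ s) ≡ p
  partnerₚ-high {i , j} l with low? (i + s , j) | s ≤? i + s
  ... | yes l′ | _      = ⊥-elim (¬low-⊕ l′)
  ... | no _  | yes _   = cong (_, j) (m+n∸n≡m i s)
  ... | no _  | no s≰   = ⊥-elim (s≰ (m≤n+m s i))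

  partnerₚ-middle : ∀ {p} → Middle p → partnerₚ p ≡ p
  partnerₚ-middle {i , j} (¬l , i<s , _) with low? (i , j) | s ≤? i
  ... | yes l | _     = ⊥-elim (¬l l)
  ... | no _  | yes s≤i = ⊥-elim (<-irrefl refl (<-≤-trans i<s s≤i))
  ... | no _  | no _  = refl

  data Paired : Point → Point → Set where
    low    : ∀ {p} → Low p → Paired p (p ⊕ s)
    high   : ∀ {p} → Low p → Paired (p ⊕ s) p
    middle : ∀ {p} → Middle p → Paired p p

  paired : ∀ {p} → InGrid p → Paired p (partnerₚ p)
  paired {i , j} g with low? (i , j) | s ≤? i
  ... | yes l | _       = low l
  ... | no _  | yes s≤i = subst (λ p → Paired p (i ∸ s , j)) (cong (_, j) (m∸n+n≡m s≤i)) (high (high-low g s≤i))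
  ... | no ¬l | no s≰i  = middle (¬l , ≰⇒> s≰i , row<3 g)
    where
    row<3 : InGrid (i , j) → j < 3
    row<3 (inj₁ (_ , j<3))  = j<3
    row<3 (inj₂ (_ , refl)) = n<1+n 2

  Paired-partnerₚ : ∀ {p q} → Paired p q → partnerₚ q ≡ p
  Paired-partnerₚ (low l)    = partnerₚ-high l
  Paired-partnerₚ (high l)   = partnerₚ-low l
  Paired-partnerₚ (middle m) = partnerₚ-middle m

  Paired-InGrid : ∀ {p q} → Paired p q → InGrid q
  Paired-InGrid (low l)                 = low-⊕-InGrid l
  Paired-InGrid (high l)                = low-InGrid l
  Paired-InGrid (middle (_ , i<s , j<3)) = inj₁ (<-≤-trans i<s (m≤n+m s k) , j<3)

  middle-near-centre : ∀ {p} → Middle p → p ≡ centreₚ ⊎ centreₚ ~ p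
  middle-near-centre {i , j} (¬l , i<s , j<3) with m≤n⇒m<n∨m≡n (s≤s⁻¹ i<s)
  ... | inj₂ refl = column-t j<3
    where
    column-t : ∀ {j} → j < 3 → (t , j) ≡ centreₚ ⊎ centreₚ ~ (t , j)
    column-t (s≤s z≤n)             = inj₂ (inj₂ (stepⱼ refl refl))
    column-t (s≤s (s≤s z≤n))       = inj₁ refl
    column-t (s≤s (s≤s (s≤s z≤n))) = inj₂ (inj₁ (stepⱼ refl refl))
  ... | inj₁ i<t = column-k j<3
    where
    k≤i : k ≤ i
    k≤i = ≮⇒≥ (λ i<k → ¬l (inj₁ (i<k , j<3)))
    i≡k : i ≡ k
    i≡k = ≤-antisym (s≤s⁻¹ (<-≤-trans i<t t≤1+k)) k≤i
    t≡1+i : t ≡ suc i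
    t≡1+i = ≤-antisym (subst (λ m → t ≤ suc m) (sym i≡k) t≤1+k) i<t
    column-k : j < 3 → (i , j) ≡ centreₚ ⊎ centreₚ ~ (i , j)
    column-k (s≤s z≤n)             = inj₂ (inj₂ (stepᵢⱼ t≡1+i refl))
    column-k (s≤s (s≤s z≤n))       = inj₂ (inj₂ (stepᵢ t≡1+i refl))
    column-k (s≤s (s≤s (s≤s z≤n))) = ⊥-elim (¬l (inj₂ (i≡k , refl)))

  low-meets-high : ∀ {i j i′} → Low (i , j) → i′ + s ≡ suc i → i ≡ t × j ≡ 2
  low-meets-high {i} {j} {i′} l e = i≡t , j≡2 l
    where
    t≤i : t ≤ i
    t≤i = s≤s⁻¹ (subst (s ≤_) e (m≤n+m s i′))
    i≡t : i ≡ t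
    i≡t = ≤-antisym (≤-trans (low-col≤k l) k≤t) t≤i
    j≡2 : Low (i , j) → j ≡ 2
    j≡2 (inj₁ (i<k , _)) = ⊥-elim (<-irrefl refl (<-≤-trans i<k (≤-trans k≤t t≤i)))
    j≡2 (inj₂ (_ , e′))  = e′

  low-high-bridge : ∀ {p q} → Low p → Low q → p ~ q ⊕ s → centreₚ ~ p × centreₚ ~ q ⊕ s
  low-high-bridge {i , _} {i′ , _} lp _ (inj₂ st) = ⊥-elim (<⇒≱ (low<high lp i′) (Step-col-≤ st))
  low-high-bridge {i , _} {i′ , _} lp _ (inj₁ (stepⱼ e _)) = ⊥-elim (<⇒≢ (low<high lp i′) (sym e))
  low-high-bridge lp _ (inj₁ (stepᵢ e e′)) with low-meets-high lp e
  ... | i≡t , j≡2 = inj₁ (stepⱼ i≡t j≡2) , inj₁ (stepᵢⱼ (trans e (cong suc i≡t)) (trans e′ j≡2))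
  low-high-bridge lp lq (inj₁ (stepᵢⱼ e e′)) with low-meets-high lp e
  ... | _ , j≡2 = ⊥-elim (<-irrefl (trans e′ (cong suc j≡2)) (low-row<3 lq))

  ¬far-middle : ∀ {p} → Farₚ p → ¬ Middle p
  ¬far-middle (p≢c , ¬c~p) m = Sum.[ p≢c , ¬c~p ] (middle-near-centre m)

  Paired-moves : ∀ {p q} → Paired p q → Farₚ p → q ≢ p
  Paired-moves (low _)    _   e = m+1+n≢m _ (cong proj₁ e)
  Paired-moves (high _)   _   e = m+1+n≢m _ (cong proj₁ (sym e))
  Paired-moves (middle m) far _ = ¬far-middle far m

  Paired-nonadjacent : ∀ {p q} → Paired p q → Farₚ p → ¬ p ~ q
  Paired-nonadjacent (low l)    (_ , ¬c~p) a = ¬c~p (proj₁ (low-high-bridge l l a))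
  Paired-nonadjacent (high l)   (_ , ¬c~p) a = ¬c~p (proj₂ (low-high-bridge l l (~-sym a)))
  Paired-nonadjacent (middle m) far        _ = ¬far-middle far m

  Paired-swap : ∀ {u u′ v v′} → Paired u u′ → Paired v v′ → Farₚ u → Farₚ v → u ~ v′ → u′ ~ v
  Paired-swap (middle m) _          far-u _     _ = ⊥-elim (¬far-middle far-u m)
  Paired-swap _          (middle m) _     far-v _ = ⊥-elim (¬far-middle far-v m)
  Paired-swap (low lu)   (low lv)   far-u _     a = ⊥-elim (proj₂ far-u (proj₁ (low-high-bridge lu lv a)))
  Paired-swap (low _)    (high _)   _     _     a = ~-⊕ s a
  Paired-swap (high _)   (low _)    _     _     a = ~-⊕⁻¹ s a
  Paired-swap (high lu)  (high lv)  far-u _     a = ⊥-elim (proj₂ far-u (proj₂ (low-high-bridge lv lu (~-sym a))))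

  centre-middle : Middle centreₚ
  centre-middle = ¬low , n<1+n t , s≤s (s≤s z≤n)
    where
    ¬low : ¬ Low centreₚ
    ¬low (inj₁ (t<k , _)) = <⇒≱ t<k k≤t
    ¬low (inj₂ (_ , ()))

  centre-InGrid : InGrid centreₚ
  centre-InGrid = Paired-InGrid (middle centre-middle)

  centre : GV N
  centre = vertexAt centreₚ centre-InGrid

  partner : GV N → GV N
  partner v = vertexAt (partnerₚ (pt v)) (Paired-InGrid (paired (pt-InGrid v)))

  pt-centre : pt centre ≡ centreₚ
  pt-centre = pt-vertexAt centreₚ centre-InGrid

  pt-partner : ∀ v → pt (partner v) ≡ partnerₚ (pt v)
  pt-partner v = pt-vertexAt (partnerₚ (pt v)) _

  Paired-pt : ∀ v → Paired (pt v) (pt (partner v))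
  Paired-pt v = subst (Paired (pt v)) (sym (pt-partner v)) (paired (pt-InGrid v))

  Far→Farₚ : ∀ {v} → Far (Gn N) centre v → Farₚ (pt v)
  Far→Farₚ {v} (v≢centre , ¬adj) =
    (λ e → v≢centre (pt-injective (trans e (sym pt-centre)))) ,
    (λ a → ¬adj (~→adj (subst (_~ pt v) (sym pt-centre) a)))

  pairing : Pairing (Gn N)
  pairing = record
    { centre              = centre
    ; partner             = partner
    ; partner-involutive  = λ v →
        pt-injective (trans (pt-partner (partner v)) (Paired-partnerₚ (Paired-pt v)))
    ; partner-centre      = pt-injective (begin
        pt (partner centre)  ≡⟨ pt-partner centre ⟩
        partnerₚ (pt centre) ≡⟨ cong partnerₚ pt-centre ⟩
        partnerₚ centreₚ     ≡⟨ partnerₚ-middle centre-middle ⟩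
        centreₚ              ≡⟨ sym pt-centre ⟩
        pt centre            ∎)
    ; partner-≢           = λ {v} far e → Paired-moves (Paired-pt v) (Far→Farₚ far) (cong pt e)
    ; partner-nonadjacent = λ {v} far a → Paired-nonadjacent (Paired-pt v) (Far→Farₚ far) (adj→~ a)
    ; partner-swap        = λ {u} {v} far-u far-v a →
        ~→adj (Paired-swap (Paired-pt u) (Paired-pt v) (Far→Farₚ far-u) (Far→Farₚ far-v) (adj→~ a))
    }
    where open ≡-Reasoning

vertices : ∀ n → List (GV n)
vertices n = map inj₁ (cartesianProduct (allFin n) (allFin 3)) ++ inj₂ tt ∷ []

∈-vertices : ∀ n (v : GV n) → v ∈ vertices n
∈-vertices n (inj₁ (i , j)) = ∈-++⁺ˡ (∈-map⁺ inj₁ (∈-cartesianProduct⁺ (∈-allFin i) (∈-allFin j)))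
∈-vertices n (inj₂ tt)      = ∈-++⁺ʳ (map inj₁ (cartesianProduct (allFin n) (allFin 3))) (here refl)

Gn-first-player-win : ∀ k t → k ≤ t → t ≤ suc k → FirstPlayerWin (Gn (k + suc t))
Gn-first-player-win k t k≤t t≤1+k =
  pairing-first-player-win (vertices _) (∈-vertices _) (Translation.pairing k t k≤t t≤1+k)

⌈n/2⌉≤1+⌊n/2⌋ : ∀ n → ⌈ n /2⌉ ≤ suc ⌊ n /2⌋
⌈n/2⌉≤1+⌊n/2⌋ zero          = z≤n
⌈n/2⌉≤1+⌊n/2⌋ (suc zero)    = ≤-refl
⌈n/2⌉≤1+⌊n/2⌋ (suc (suc n)) = s≤s (⌈n/2⌉≤1+⌊n/2⌋ n)

lemma3p6 : (n : ℕ) → n ≥ 1 → FirstPlayerWin (Gn n)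
lemma3p6 (suc m) _ = subst (FirstPlayerWin ∘ Gn) size
  (Gn-first-player-win ⌊ m /2⌋ ⌈ m /2⌉ (⌊n/2⌋≤⌈n/2⌉ m) (⌈n/2⌉≤1+⌊n/2⌋ m))
  where
  size : ⌊ m /2⌋ + suc ⌈ m /2⌉ ≡ suc m
  size = trans (+-suc ⌊ m /2⌋ ⌈ m /2⌉) (cong suc (⌊n/2⌋+⌈n/2⌉≡n m))
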